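{- For $n\ge1$, the rock-breaking Markov chain $P_n$ on partitions of $n$ has eigenvalues $1/2^i$, $0\le i\le n-1$, with $1/2^i$ having multiplicity $p(n,n-i)$, the number of partitions of $n$ into $n-i$ parts.
   Context: The rock-breaking chain $P_n$: the state space is the set of partitions of $n$. From a partition $\lambda=(\lambda_1,\dots,\lambda_l)$, each part $\lambda_j$ is independently split into two pieces of sizes $B_j$ and $\lambda_j-B_j$, where $B_j$ has the Binomial$(\lambda_j,1/2)$ distribution, i.e. $P(B_j=i)=\binom{\lambda_j}{i}/2^{\lambda_j}$; pieces of size $0$ are discarded, and the new state is the partition formed by all the resulting nonzero pieces. $P_n(\lambda,\mu)$ denotes the probability of moving from $\lambda$ to $\mu$ in one step. -}

module Defs where

open import Data.Nat as ℕ using (ℕ; zero; suc; _∸_; _⊓_; _≤ᵇ_)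
open import Data.Nat.Combinatorics using (_C_)
open import Data.Integer using (+_)
open import Data.Rational using (ℚ; 0ℚ; 1ℚ; ½; _+_; _*_; _-_; -_; _/_)
open import Data.List as L using (List; []; _∷_; _++_; map; concatMap; upTo; applyUpTo; length; filter; lookup; foldr)
open import Data.List.Properties using (≡-dec)
open import Data.Fin using (Fin; zero; suc; toℕ; punchIn)
open import Data.Product using (_×_; _,_)
open import Data.Bool using (Bool; true; false; if_then_else_)
open import Relation.Nullary using (does)

-- Partitions of n: non-increasing lists of positive naturals summing to n.

-- partitions of n with all parts ≤ m (fuel f ≥ n guarantees completeness,
-- since every part is ≥ 1)
partsGo : ℕ → ℕ → ℕ → List (List ℕ)
partsGo _       _ zero    = [] ∷ []
partsGo zero    _ (suc _) = []
partsGo (suc f) m (suc n) =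
  concatMap (λ k → map (k ∷_) (partsGo f k (suc n ∸ k))) (applyUpTo suc (m ⊓ suc n))

partitions : ℕ → List (List ℕ)
partitions n = partsGo n n n

p : ℕ → ℕ → ℕ
p n k = length (filter (λ μ → length μ ℕ.≟ k) (partitions n))

_^ℚ_ : ℚ → ℕ → ℚ
q ^ℚ zero  = 1ℚ
q ^ℚ suc k = q * (q ^ℚ k)

sumℚ : List ℚ → ℚ
sumℚ = foldr _+_ 0ℚ

prodℚ : List ℚ → ℚ
prodℚ = foldr _*_ 1ℚ

insertDesc : ℕ → List ℕ → List ℕ
insertDesc x []       = x ∷ []
insertDesc x (y ∷ ys) = if y ≤ᵇ x then x ∷ y ∷ ys else y ∷ insertDesc x ys

sortDesc : List ℕ → List ℕ
sortDesc = foldr insertDesc []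

nonzero : List ℕ → List ℕ
nonzero = filter (λ a → 1 ℕ.≤? a)

-- all joint outcomes of splitting every part λ_j into B_j and λ_j - B_j,
-- with B_j ~ Binomial(λ_j, 1/2) independent: (list of pieces, probability)
outcomes : List ℕ → List (List ℕ × ℚ)
outcomes []      = ([] , 1ℚ) ∷ []
outcomes (a ∷ l) =
  concatMap (λ b → map (λ { (ps , w) →
      (b ∷ (a ∸ b) ∷ ps , ((+ (a C b)) / 1) * (½ ^ℚ a) * w) })
    (outcomes l))
  (upTo (suc a))

P : List ℕ → List ℕ → ℚ
P λ' μ = sumℚ (map (λ { (ps , w) →
    if does (≡-dec ℕ._≟_ (sortDesc (nonzero ps)) μ) then w else 0ℚ })
  (outcomes λ'))

sgn : ℕ → ℚ
sgn zero          = 1ℚ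
sgn (suc zero)    = - 1ℚ
sgn (suc (suc k)) = sgn k

det : (m : ℕ) → (Fin m → Fin m → ℚ) → ℚ
det zero    M = 1ℚ
det (suc m) M = sumℚ (L.map (λ j → sgn (toℕ j) * M zero j *
                      det m (λ i k → M (suc i) (punchIn j k)))
                    (L.allFin (suc m)))

δ : {m : ℕ} → Fin m → Fin m → ℚ
δ zero    zero    = 1ℚ
δ zero    (suc _) = 0ℚ
δ (suc _) zero    = 0ℚ
δ (suc i) (suc j) = δ i j

Pmat : (n : ℕ) → Fin (length (partitions n)) → Fin (length (partitions n)) → ℚ
Pmat n i j = P (lookup (partitions n) i) (lookup (partitions n) j)

charPoly : ℕ → ℚ → ℚ
charPoly n x = det (length (partitions n)) (λ i j → x * δ i j - Pmat n i j)

-- Order partitions lexicographically, parts listed in decreasing order. Breaking rocks never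
-- increases a partition in this order, and partitions n enumerates the partitions in
-- increasing order, so P_n is lower triangular and det (x I - P_n) is the product of the
-- factors x - P_n(λ, λ). A step stays at λ only if every part λ_j is split as (0, λ_j) or
-- (λ_j, 0), which has probability 2 / 2^λ_j; hence P_n(λ, λ) = 2^-(n - ℓ(λ)), and grouping
-- the partitions by their number of parts ℓ(λ) yields the multiplicities p(n, n - i).
module Submission where

open import Defs
open import Algebra.Bundles using (CommutativeMonoid)
import Algebra.Properties.CommutativeSemigroup as CommutativeSemigroupProperties
open import Data.Bool using (true; false; if_then_else_)
import Data.Bool.Properties as Bool
open import Data.Empty using (⊥-elim)
open import Data.Fin using (Fin; zero; suc; toℕ; punchIn)
import Data.Integer as ℤ
open import Data.List as List
  using (List; []; _∷_; _++_; map; concatMap; upTo; applyUpTo; tabulate; lookup; length; filter)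
import Data.List.Properties as List
open import Data.List.Membership.Propositional.Properties using (∈-lookup)
open import Data.List.Relation.Binary.Lex.Strict as Lex using (Lex-<; Lex-≤; base; halt; this; next)
import Data.List.Relation.Binary.Pointwise as Pointwise
open import Data.List.Relation.Unary.All as All using (All; []; _∷_)
import Data.List.Relation.Unary.All.Properties as All
open import Data.List.Relation.Unary.AllPairs as AllPairs using (AllPairs; []; _∷_)
import Data.List.Relation.Unary.AllPairs.Properties as AllPairs
open import Data.Nat as ℕ using (ℕ; zero; suc; z≤n; s≤s; _∸_; _⊓_)
open import Data.Nat.Combinatorics using (_C_; nCn≡1; nCk≡nC[n∸k])
import Data.Nat.ListAction as ℕ
import Data.Nat.Properties as ℕ
open import Data.Product using (_×_; _,_; proj₁)
open import Data.Rational using (ℚ; 0ℚ; 1ℚ; ½; _+_; _*_; _-_; _/_)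
import Data.Rational.Properties as ℚ
open import Data.Rational.Solver using (module +-*-Solver)
open import Data.Sum using (_⊎_; inj₁; inj₂)
open import Data.Unit using (⊤; tt)
open import Function using (_∘_; id; mk⇔)
open import Relation.Binary.Core using (Rel)
open import Relation.Binary.Definitions using (DecidableEquality; Transitive)
open import Relation.Binary.PropositionalEquality as ≡ using (_≡_; _≢_; refl; cong; cong₂)
open import Relation.Nullary using (¬_; yes; no; does)
open import Relation.Nullary.Decidable using (dec-true; dec-false; does-⇔)

-- Sums, products and determinants

module FoldProperties {c ℓ} (M : CommutativeMonoid c ℓ) where

  open CommutativeMonoid M renaming (refl to ≈-refl; sym to ≈-sym; trans to ≈-trans)
  open CommutativeSemigroupProperties commutativeSemigroup using (interchange)

  fold : List Carrier → Carrier
  fold = List.foldr _∙_ ε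

  fold-++ : ∀ xs ys → fold (xs ++ ys) ≈ fold xs ∙ fold ys
  fold-++ []       ys = ≈-sym (identityˡ _)
  fold-++ (x ∷ xs) ys = ≈-trans (∙-congˡ (fold-++ xs ys)) (≈-sym (assoc x _ _))

  fold-map-concatMap : ∀ {a b} {A : Set a} {B : Set b} (f : B → Carrier) (g : A → List B) xs →
                       fold (map f (concatMap g xs)) ≈ fold (map (fold ∘ map f ∘ g) xs)
  fold-map-concatMap f g []       = ≈-refl
  fold-map-concatMap f g (x ∷ xs) = ≈-trans
    (reflexive (cong fold (List.map-++ f (g x) (concatMap g xs))))
    (≈-trans (fold-++ (map f (g x)) _) (∙-congˡ (fold-map-concatMap f g xs)))

  fold-ε : ∀ {xs} → All (_≈ ε) xs → fold xs ≈ ε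
  fold-ε []           = ≈-refl
  fold-ε (x≈ε ∷ xs≈ε) = ≈-trans (∙-cong x≈ε (fold-ε xs≈ε)) (identityˡ ε)

  fold-applyUpTo-single : ∀ {m v} (F : ℕ → Carrier) → v ℕ.< m →
                          (∀ {i} → i ℕ.< m → i ≢ v → F i ≈ ε) → fold (applyUpTo F m) ≈ F v
  fold-applyUpTo-single {suc m} {zero} F _ others = ≈-trans
    (∙-congˡ (fold-ε (All.applyUpTo⁺₁ (F ∘ suc) m λ i<m → others (s≤s i<m) λ ())))
    (identityʳ (F 0))
  fold-applyUpTo-single {suc m} {suc v} F (s≤s v<m) others = ≈-trans
    (∙-cong (others (s≤s z≤n) λ ())
            (fold-applyUpTo-single (F ∘ suc) v<m λ i<m i≢v →
               others (s≤s i<m) (i≢v ∘ ℕ.suc-injective)))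
    (identityˡ _)

  fold-map-∙ : ∀ {a} {A : Set a} (f g : A → Carrier) xs →
               fold (map (λ x → f x ∙ g x) xs) ≈ fold (map f xs) ∙ fold (map g xs)
  fold-map-∙ f g []       = ≈-sym (identityˡ ε)
  fold-map-∙ f g (x ∷ xs) = ≈-trans (∙-congˡ (fold-map-∙ f g xs)) (interchange (f x) (g x) _ _)

module Sum  = FoldProperties ℚ.+-0-commutativeMonoid
module Prod = FoldProperties ℚ.*-1-commutativeMonoid

sumℚ-*ˡ : ∀ {a} {A : Set a} k (f : A → ℚ) xs →
          sumℚ (map (λ x → k * f x) xs) ≡ k * sumℚ (map f xs)
sumℚ-*ˡ k f []       = ≡.sym (ℚ.*-zeroʳ k)
sumℚ-*ˡ k f (x ∷ xs) =
  ≡.trans (cong (k * f x +_) (sumℚ-*ˡ k f xs)) (≡.sym (ℚ.*-distribˡ-+ k (f x) _))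

^ℚ-+ : ∀ q m n → q ^ℚ (m ℕ.+ n) ≡ q ^ℚ m * q ^ℚ n
^ℚ-+ q zero    n = ≡.sym (ℚ.*-identityˡ _)
^ℚ-+ q (suc m) n = ≡.trans (cong (q *_) (^ℚ-+ q m n)) (≡.sym (ℚ.*-assoc q _ _))

δ-refl : ∀ {m} (i : Fin m) → δ i i ≡ 1ℚ
δ-refl zero    = refl
δ-refl (suc i) = δ-refl i

δ-< : ∀ {m} {i j : Fin m} → toℕ i ℕ.< toℕ j → δ i j ≡ 0ℚ
δ-< {i = zero}  {suc j} _         = refl
δ-< {i = suc i} {suc j} (s≤s i<j) = δ-< i<j

LowerTriangular : ∀ {m} → (Fin m → Fin m → ℚ) → Set
LowerTriangular M = ∀ {i j} → toℕ i ℕ.< toℕ j → M i j ≡ 0ℚ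

det-lowerTriangular : ∀ m (M : Fin m → Fin m → ℚ) → LowerTriangular M →
                      det m M ≡ prodℚ (tabulate (λ i → M i i))
det-lowerTriangular zero    M _     = refl
det-lowerTriangular (suc m) M lower = begin
    det (suc m) M
  ≡⟨ cong (λ ts → term zero + sumℚ ts) (List.map-tabulate suc term) ⟩
    term zero + sumℚ (tabulate (term ∘ suc))
  ≡⟨ cong (term zero +_) (Sum.fold-ε (All.tabulate⁺ first-row-vanishes)) ⟩
    term zero + 0ℚ
  ≡⟨ ℚ.+-identityʳ _ ⟩
    1ℚ * M zero zero * det m (minor zero)
  ≡⟨ cong (_* det m (minor zero)) (ℚ.*-identityˡ (M zero zero)) ⟩
    M zero zero * det m (minor zero)
  ≡⟨ cong (M zero zero *_) (det-lowerTriangular m (minor zero) (lower ∘ s≤s)) ⟩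
    prodℚ (tabulate (λ i → M i i))
  ∎
  where
  open ≡.≡-Reasoning
  minor : Fin (suc m) → Fin m → Fin m → ℚ
  minor j i k = M (suc i) (punchIn j k)
  term : Fin (suc m) → ℚ
  term j = sgn (toℕ j) * M zero j * det m (minor j)
  first-row-vanishes : ∀ j → term (suc j) ≡ 0ℚ
  first-row-vanishes j = begin
      sgn (suc (toℕ j)) * M zero (suc j) * det m (minor (suc j))
    ≡⟨ cong (λ z → sgn (suc (toℕ j)) * z * det m (minor (suc j))) (lower (s≤s z≤n)) ⟩
      sgn (suc (toℕ j)) * 0ℚ * det m (minor (suc j))
    ≡⟨ cong (_* det m (minor (suc j))) (ℚ.*-zeroʳ (sgn (suc (toℕ j)))) ⟩
      0ℚ * det m (minor (suc j))
    ≡⟨ ℚ.*-zeroˡ (det m (minor (suc j))) ⟩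
      0ℚ
    ∎

-- Lexicographic order and insertion sort

_<ₗ_ _≤ₗ_ : Rel (List ℕ) _
_<ₗ_ = Lex-< _≡_ ℕ._<_
_≤ₗ_ = Lex-≤ _≡_ ℕ._<_

≤ₗ-refl : ∀ {xs} → xs ≤ₗ xs
≤ₗ-refl = Lex.≤-reflexive _≡_ ℕ._<_ (Pointwise.≡⇒Pointwise-≡ refl)

≤ₗ-trans : Transitive _≤ₗ_
≤ₗ-trans = Lex.≤-transitive ≡.isEquivalence (≡.resp₂ ℕ._<_) ℕ.<-trans

≤ₗ-<ₗ-trans : ∀ {xs ys zs} → xs ≤ₗ ys → ys <ₗ zs → xs <ₗ zs
≤ₗ-<ₗ-trans (base _)      ys<zs         = ys<zs
≤ₗ-<ₗ-trans halt          (this _)      = halt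
≤ₗ-<ₗ-trans halt          (next _ _)    = halt
≤ₗ-<ₗ-trans (this x<y)    (this y<z)    = this (ℕ.<-trans x<y y<z)
≤ₗ-<ₗ-trans (this x<y)    (next refl _) = this x<y
≤ₗ-<ₗ-trans (next refl _) (this y<z)    = this y<z
≤ₗ-<ₗ-trans (next refl p) (next refl q) = next refl (≤ₗ-<ₗ-trans p q)

<ₗ-irrefl : ∀ {xs} → ¬ xs <ₗ xs
<ₗ-irrefl = Lex.<-irreflexive ℕ.<-irrefl (Pointwise.≡⇒Pointwise-≡ refl)

Head : Rel ℕ _ → List ℕ → ℕ → Set
Head R []      x = ⊤
Head R (y ∷ _) x = R y x

Descending : List ℕ → Set
Descending []       = ⊤
Descending (x ∷ xs) = Head ℕ._≤_ xs x × Descending xs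

insertDesc-≤ : ∀ {x y} ys → y ℕ.≤ x → insertDesc x (y ∷ ys) ≡ x ∷ y ∷ ys
insertDesc-≤ {x} {y} ys y≤x =
  cong (λ b → if b then x ∷ y ∷ ys else y ∷ insertDesc x ys) (dec-true (y ℕ.≤? x) y≤x)

insertDesc-> : ∀ {x y} ys → x ℕ.< y → insertDesc x (y ∷ ys) ≡ y ∷ insertDesc x ys
insertDesc-> {x} {y} ys x<y =
  cong (λ b → if b then x ∷ y ∷ ys else y ∷ insertDesc x ys) (dec-false (y ℕ.≤? x) (ℕ.<⇒≱ x<y))

insertDesc-mono-≤ₗ : ∀ x {xs ys} → xs ≤ₗ ys → insertDesc x xs ≤ₗ insertDesc x ys
insertDesc-mono-≤ₗ x (base _) = ≤ₗ-refl
insertDesc-mono-≤ₗ x (halt {y} {ys}) with y ℕ.≤? x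
... | yes y≤x rewrite insertDesc-≤ ys y≤x             = next refl halt
... | no  y≰x rewrite insertDesc-> ys (ℕ.≰⇒> y≰x) = this (ℕ.≰⇒> y≰x)
insertDesc-mono-≤ₗ x (this {s} {xs} {t} {ys} s<t) with t ℕ.≤? x
... | yes t≤x rewrite insertDesc-≤ ys t≤x
                    | insertDesc-≤ xs (ℕ.≤-trans (ℕ.<⇒≤ s<t) t≤x) = next refl (this s<t)
... | no  t≰x with s ℕ.≤? x
...   | yes s≤x rewrite insertDesc-> ys (ℕ.≰⇒> t≰x) | insertDesc-≤ xs s≤x = this (ℕ.≰⇒> t≰x)
...   | no  s≰x rewrite insertDesc-> ys (ℕ.≰⇒> t≰x) | insertDesc-> xs (ℕ.≰⇒> s≰x) = this s<t
insertDesc-mono-≤ₗ x (next {s} {xs} {_} {ys} refl xs≤ys) with s ℕ.≤? x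
... | yes s≤x rewrite insertDesc-≤ xs s≤x | insertDesc-≤ ys s≤x = next refl (next refl xs≤ys)
... | no  s≰x rewrite insertDesc-> xs (ℕ.≰⇒> s≰x) | insertDesc-> ys (ℕ.≰⇒> s≰x) =
  next refl (insertDesc-mono-≤ₗ x xs≤ys)

Head-insertDesc : ∀ {R x a} ys → Head R ys a → R x a → Head R (insertDesc x ys) a
Head-insertDesc []                 _   Rxa = Rxa
Head-insertDesc {x = x} (y ∷ ys) Rya Rxa with y ℕ.≤? x
... | yes y≤x rewrite insertDesc-≤ ys y≤x             = Rxa
... | no  y≰x rewrite insertDesc-> ys (ℕ.≰⇒> y≰x) = Rya

Head<-≤ₗ : ∀ {a} xs ys → Head ℕ._<_ xs a → xs ≤ₗ (a ∷ ys)
Head<-≤ₗ []       ys _   = halt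
Head<-≤ₗ (x ∷ xs) ys x<a = this x<a

insertDesc-descending : ∀ x xs → Descending xs → Descending (insertDesc x xs)
insertDesc-descending x []       _          = tt , tt
insertDesc-descending x (y ∷ xs) (hd , dxs) with y ℕ.≤? x
... | yes y≤x rewrite insertDesc-≤ xs y≤x = y≤x , hd , dxs
... | no  y≰x rewrite insertDesc-> xs (ℕ.≰⇒> y≰x) =
  Head-insertDesc xs hd (ℕ.<⇒≤ (ℕ.≰⇒> y≰x)) , insertDesc-descending x xs dxs

insertDesc-head : ∀ x xs → Head ℕ._≤_ xs x → insertDesc x xs ≡ x ∷ xs
insertDesc-head x []       _   = refl
insertDesc-head x (y ∷ xs) y≤x = insertDesc-≤ xs y≤x

sortDesc-descending : ∀ xs → Descending (sortDesc xs)
sortDesc-descending []       = tt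
sortDesc-descending (x ∷ xs) = insertDesc-descending x (sortDesc xs) (sortDesc-descending xs)

sortDesc-descending-id : ∀ xs → Descending xs → sortDesc xs ≡ xs
sortDesc-descending-id []       _          = refl
sortDesc-descending-id (x ∷ xs) (hd , dxs) rewrite sortDesc-descending-id xs dxs =
  insertDesc-head x xs hd

length-insertDesc : ∀ x xs → length (insertDesc x xs) ≡ suc (length xs)
length-insertDesc x []       = refl
length-insertDesc x (y ∷ xs) with y ℕ.≤? x
... | yes y≤x rewrite insertDesc-≤ xs y≤x             = refl
... | no  y≰x rewrite insertDesc-> xs (ℕ.≰⇒> y≰x) = cong suc (length-insertDesc x xs)

length-sortDesc : ∀ xs → length (sortDesc xs) ≡ length xs
length-sortDesc []       = refl
length-sortDesc (x ∷ xs) =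
  ≡.trans (length-insertDesc x (sortDesc xs)) (cong suc (length-sortDesc xs))

insertDesc-split-≤ₗ : ∀ {a b c} xs → Descending xs → b ℕ.< a → c ℕ.< a →
                      insertDesc b (insertDesc c xs) ≤ₗ insertDesc a xs
insertDesc-split-≤ₗ {a} {b} {c} [] _ b<a c<a =
  Head<-≤ₗ (insertDesc b (c ∷ [])) [] (Head-insertDesc (c ∷ []) c<a b<a)
insertDesc-split-≤ₗ {a} {b} {c} (y ∷ xs) (hd , dxs) b<a c<a with y ℕ.≤? a
... | no y≰a rewrite insertDesc-> xs (ℕ.≰⇒> y≰a)
                   | insertDesc-> xs (ℕ.<-trans c<a (ℕ.≰⇒> y≰a))
                   | insertDesc-> (insertDesc c xs) (ℕ.<-trans b<a (ℕ.≰⇒> y≰a)) =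
  next refl (insertDesc-split-≤ₗ xs dxs b<a c<a)
... | yes y≤a rewrite insertDesc-≤ xs y≤a with ℕ.m≤n⇒m<n∨m≡n y≤a
...   | inj₁ y<a = Head<-≤ₗ (insertDesc b (insertDesc c (y ∷ xs))) (y ∷ xs)
  (Head-insertDesc (insertDesc c (y ∷ xs)) (Head-insertDesc (y ∷ xs) y<a c<a) b<a)
...   | inj₂ refl rewrite insertDesc-> xs c<a | insertDesc-> (insertDesc c xs) b<a =
  next refl (≡.subst (insertDesc b (insertDesc c xs) ≤ₗ_) (insertDesc-head y xs hd)
                     (insertDesc-split-≤ₗ xs dxs b<a c<a))

-- Outcomes of one breaking step

Positive : List ℕ → Set
Positive = All (1 ℕ.≤_)

_≟ₗ_ : DecidableEquality (List ℕ)
_≟ₗ_ = List.≡-dec ℕ._≟_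

nonzero-∷ : ∀ {x} xs → 1 ℕ.≤ x → nonzero (x ∷ xs) ≡ x ∷ nonzero xs
nonzero-∷ xs (s≤s z≤n) = refl

length≤sum : ∀ xs → Positive xs → length xs ℕ.≤ ℕ.sum xs
length≤sum []       _           = z≤n
length≤sum (x ∷ xs) (1≤x ∷ pxs) = ℕ.+-mono-≤ 1≤x (length≤sum xs pxs)

outcomes-invariant : (R : List ℕ → List ℕ → Set) → R [] [] →
  (∀ a b xs ps → 1 ℕ.≤ a → b ℕ.≤ a → R xs ps → R (a ∷ xs) (b ∷ (a ∸ b) ∷ ps)) →
  ∀ xs → Positive xs → All (R xs ∘ proj₁) (outcomes xs)
outcomes-invariant R R[] R-step []       _           = R[] ∷ []
outcomes-invariant R R[] R-step (a ∷ xs) (1≤a ∷ pxs) =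
  All.concat⁺ (All.map⁺ (All.applyUpTo⁺₁ id (suc a) λ {b} b<1+a →
    All.map⁺ (All.map (λ {o} → R-step a b xs (proj₁ o) 1≤a (ℕ.≤-pred b<1+a))
                      (outcomes-invariant R R[] R-step xs pxs))))

data Breaking (a b : ℕ) (ps : List ℕ) : Set where
  unbroken : nonzero (b ∷ (a ∸ b) ∷ ps) ≡ a ∷ nonzero ps → Breaking a b ps
  broken   : b ℕ.< a → a ∸ b ℕ.< a →
             nonzero (b ∷ (a ∸ b) ∷ ps) ≡ b ∷ (a ∸ b) ∷ nonzero ps → Breaking a b ps

breaking : ∀ {a b} ps → 1 ℕ.≤ a → b ℕ.≤ a → Breaking a b ps
breaking {a} {zero}  ps 1≤a _ = unbroken (nonzero-∷ ps 1≤a)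
breaking {a} {suc b} ps _ b<a with ℕ.m≤n⇒m<n∨m≡n b<a
... | inj₂ refl  = unbroken (cong (λ c → nonzero (suc b ∷ c ∷ ps)) (ℕ.n∸n≡0 b))
... | inj₁ 1+b<a = broken 1+b<a (ℕ.∸-monoʳ-< (s≤s z≤n) b<a)
  (≡.trans (nonzero-∷ ((a ∸ suc b) ∷ ps) (s≤s z≤n))
           (cong (suc b ∷_) (nonzero-∷ ps (ℕ.m<n⇒0<n∸m 1+b<a))))

outcomes-≤ₗ : ∀ xs → Positive xs →
              All (λ o → sortDesc (nonzero (proj₁ o)) ≤ₗ sortDesc xs) (outcomes xs)
outcomes-≤ₗ = outcomes-invariant (λ xs ps → sortDesc (nonzero ps) ≤ₗ sortDesc xs) (base tt) step
  where
  step : ∀ a b xs ps → 1 ℕ.≤ a → b ℕ.≤ a → sortDesc (nonzero ps) ≤ₗ sortDesc xs →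
         sortDesc (nonzero (b ∷ (a ∸ b) ∷ ps)) ≤ₗ insertDesc a (sortDesc xs)
  step a b xs ps 1≤a b≤a ps≤xs with breaking ps 1≤a b≤a
  ... | unbroken eq rewrite eq = insertDesc-mono-≤ₗ a ps≤xs
  ... | broken b<a a∸b<a eq rewrite eq = ≤ₗ-trans
    (insertDesc-split-≤ₗ (sortDesc (nonzero ps)) (sortDesc-descending (nonzero ps)) b<a a∸b<a)
    (insertDesc-mono-≤ₗ a ps≤xs)

Unbroken⊎MorePieces : List ℕ → List ℕ → Set
Unbroken⊎MorePieces xs ps = nonzero ps ≡ xs ⊎ length xs ℕ.< length (nonzero ps)

outcomes-unbroken⊎morePieces : ∀ xs → Positive xs →
                               All (Unbroken⊎MorePieces xs ∘ proj₁) (outcomes xs)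
outcomes-unbroken⊎morePieces = outcomes-invariant Unbroken⊎MorePieces (inj₁ refl) step
  where
  length≤pieces : ∀ {xs ps} → Unbroken⊎MorePieces xs ps → length xs ℕ.≤ length (nonzero ps)
  length≤pieces (inj₁ refl) = ℕ.≤-refl
  length≤pieces (inj₂ more) = ℕ.<⇒≤ more
  step : ∀ a b xs ps → 1 ℕ.≤ a → b ℕ.≤ a → Unbroken⊎MorePieces xs ps →
         Unbroken⊎MorePieces (a ∷ xs) (b ∷ (a ∸ b) ∷ ps)
  step a b xs ps 1≤a b≤a u with breaking ps 1≤a b≤a
  step a b xs ps _ _ (inj₁ eq)   | unbroken eq′ rewrite eq′ = inj₁ (cong (a ∷_) eq)
  step a b xs ps _ _ (inj₂ more) | unbroken eq′ rewrite eq′ = inj₂ (s≤s more)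
  step a b xs ps _ _ u           | broken _ _ eq rewrite eq =
    inj₂ (s≤s (s≤s (length≤pieces {xs} {ps} u)))

-- Transition probabilities

contribution : List ℕ → List ℕ × ℚ → ℚ
contribution μ (ps , w) = if does (sortDesc (nonzero ps) ≟ₗ μ) then w else 0ℚ

P-<ₗ : ∀ {λ′ μ} → Positive λ′ → Descending λ′ → λ′ <ₗ μ → P λ′ μ ≡ 0ℚ
P-<ₗ {λ′} {μ} pos desc λ′<μ =
  Sum.fold-ε (All.map⁺ (All.map (λ {o} → vanishes o) (outcomes-≤ₗ λ′ pos)))
  where
  vanishes : ∀ o → sortDesc (nonzero (proj₁ o)) ≤ₗ sortDesc λ′ → contribution μ o ≡ 0ℚ
  vanishes (ps , w) ps≤λ′ = cong (λ d → if d then w else 0ℚ)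
    (dec-false (sortDesc (nonzero ps) ≟ₗ μ) λ { refl →
      <ₗ-irrefl (≤ₗ-<ₗ-trans (≡.subst (_ ≤ₗ_) (sortDesc-descending-id λ′ desc) ps≤λ′) λ′<μ) })

exactly : List ℕ → List ℕ × ℚ → ℚ
exactly μ (ps , w) = if does (nonzero ps ≟ₗ μ) then w else 0ℚ

Punsorted : List ℕ → List ℕ → ℚ
Punsorted λ′ μ = sumℚ (map (exactly μ) (outcomes λ′))

-- No sorting is needed on the diagonal: an outcome that sorts to λ′ has split no part.
P≡Punsorted : ∀ {λ′} → Positive λ′ → Descending λ′ → P λ′ λ′ ≡ Punsorted λ′ λ′
P≡Punsorted {λ′} pos desc = cong sumℚ
  (List.map-cong-local (All.map (λ {o} → agree o) (outcomes-unbroken⊎morePieces λ′ pos)))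
  where
  agree : ∀ o → Unbroken⊎MorePieces λ′ (proj₁ o) → contribution λ′ o ≡ exactly λ′ o
  agree (ps , w) u = cong (λ d → if d then w else 0ℚ)
    (does-⇔ (mk⇔ (unsort u) (λ eq → ≡.trans (cong sortDesc eq) (sortDesc-descending-id λ′ desc)))
            (sortDesc (nonzero ps) ≟ₗ λ′) (nonzero ps ≟ₗ λ′))
    where
    unsort : Unbroken⊎MorePieces λ′ ps → sortDesc (nonzero ps) ≡ λ′ → nonzero ps ≡ λ′
    unsort (inj₁ eq)   _  = eq
    unsort (inj₂ more) eq = ⊥-elim (ℕ.<-irrefl
      (≡.trans (≡.sym (cong length eq)) (length-sortDesc (nonzero ps))) more)

breakFirst : ℕ → ℕ → List ℕ × ℚ → List ℕ × ℚ
breakFirst a b (ps , w) = b ∷ (a ∸ b) ∷ ps , (ℤ.+ (a C b) / 1) * (½ ^ℚ a) * w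

diagonalShare : ℕ → List ℕ → ℕ → ℚ
diagonalShare a xs b = sumℚ (map (exactly (a ∷ xs)) (map (breakFirst a b) (outcomes xs)))

Punsorted-∷ : ∀ a xs →
              Punsorted (a ∷ xs) (a ∷ xs) ≡ sumℚ (map (diagonalShare a xs) (upTo (suc a)))
Punsorted-∷ a xs =
  Sum.fold-map-concatMap (exactly (a ∷ xs)) (λ b → map (breakFirst a b) (outcomes xs)) (upTo (suc a))

diagonalShare-unbroken : ∀ a xs b → a C b ≡ 1 →
                         (∀ ps → nonzero (b ∷ (a ∸ b) ∷ ps) ≡ a ∷ nonzero ps) →
                         diagonalShare a xs b ≡ ½ ^ℚ a * Punsorted xs xs
diagonalShare-unbroken a xs b aCb≡1 stays-whole =
  ≡.trans (cong sumℚ (≡.trans (≡.sym (List.map-∘ (outcomes xs))) (List.map-cong share (outcomes xs))))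
          (sumℚ-*ˡ (½ ^ℚ a) (exactly xs) (outcomes xs))
  where
  open ≡.≡-Reasoning
  k = (ℤ.+ (a C b) / 1) * (½ ^ℚ a)
  share : ∀ o → exactly (a ∷ xs) (breakFirst a b o) ≡ ½ ^ℚ a * exactly xs o
  share (ps , w) = begin
      (if does (nonzero (b ∷ (a ∸ b) ∷ ps) ≟ₗ (a ∷ xs)) then k * w else 0ℚ)
    ≡⟨ cong (λ ys → if does (ys ≟ₗ (a ∷ xs)) then k * w else 0ℚ) (stays-whole ps) ⟩
      (if does ((a ∷ nonzero ps) ≟ₗ (a ∷ xs)) then k * w else 0ℚ)
    ≡⟨ cong (λ d → if d then k * w else 0ℚ) (does-⇔ (mk⇔ List.∷-injectiveʳ (cong (a ∷_)))
                                                    ((a ∷ nonzero ps) ≟ₗ (a ∷ xs)) (nonzero ps ≟ₗ xs)) ⟩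
      (if does (nonzero ps ≟ₗ xs) then k * w else 0ℚ)
    ≡⟨ cong (if does (nonzero ps ≟ₗ xs) then k * w else_) (≡.sym (ℚ.*-zeroʳ k)) ⟩
      (if does (nonzero ps ≟ₗ xs) then k * w else k * 0ℚ)
    ≡⟨ Bool.if-float (k *_) (does (nonzero ps ≟ₗ xs)) ⟨
      k * exactly xs (ps , w)
    ≡⟨ cong (λ c → (ℤ.+ c / 1) * (½ ^ℚ a) * exactly xs (ps , w)) aCb≡1 ⟩
      1ℚ * (½ ^ℚ a) * exactly xs (ps , w)
    ≡⟨ cong (_* exactly xs (ps , w)) (ℚ.*-identityˡ (½ ^ℚ a)) ⟩
      ½ ^ℚ a * exactly xs (ps , w)
    ∎

diagonalShare-broken : ∀ a xs b → 1 ℕ.≤ b → b ℕ.< a → diagonalShare a xs b ≡ 0ℚ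
diagonalShare-broken a xs b 1≤b b<a =
  Sum.fold-ε (All.map⁺ (All.map⁺ (All.universal share (outcomes xs))))
  where
  share : ∀ o → exactly (a ∷ xs) (breakFirst a b o) ≡ 0ℚ
  share (ps , w) = cong (λ d → if d then _ else 0ℚ)
    (dec-false (nonzero (b ∷ (a ∸ b) ∷ ps) ≟ₗ (a ∷ xs)) λ eq →
      ℕ.<-irrefl (List.∷-injectiveˡ (≡.trans (≡.sym (nonzero-∷ ((a ∸ b) ∷ ps) 1≤b)) eq)) b<a)

Punsorted-diag : ∀ xs → Positive xs → Punsorted xs xs ≡ ½ ^ℚ (ℕ.sum xs ∸ length xs)
Punsorted-diag []           _         = refl
Punsorted-diag (suc a ∷ xs) (_ ∷ pxs) = begin
    Punsorted (suc a ∷ xs) (suc a ∷ xs)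
  ≡⟨ Punsorted-∷ (suc a) xs ⟩
    share 0 + sumℚ (map share (applyUpTo suc (suc a)))
  ≡⟨ cong (share 0 +_) (≡.trans (cong sumℚ (List.map-applyUpTo suc share (suc a)))
       (Sum.fold-applyUpTo-single (share ∘ suc) ℕ.≤-refl λ i<1+a i≢a →
          diagonalShare-broken (suc a) xs _ (s≤s z≤n) (s≤s (ℕ.≤∧≢⇒< (ℕ.≤-pred i<1+a) i≢a)))) ⟩
    share 0 + share (suc a)
  ≡⟨ cong₂ _+_ (diagonalShare-unbroken (suc a) xs 0 1+aC0≡1 λ _ → refl)
               (diagonalShare-unbroken (suc a) xs (suc a) (nCn≡1 (suc a))
                  λ ps → cong (λ c → nonzero (suc a ∷ c ∷ ps)) (ℕ.n∸n≡0 a)) ⟩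
    (½ * ½ ^ℚ a) * Punsorted xs xs + (½ * ½ ^ℚ a) * Punsorted xs xs
  ≡⟨ halves (½ ^ℚ a) (Punsorted xs xs) ⟩
    ½ ^ℚ a * Punsorted xs xs
  ≡⟨ cong (½ ^ℚ a *_) (Punsorted-diag xs pxs) ⟩
    ½ ^ℚ a * ½ ^ℚ (ℕ.sum xs ∸ length xs)
  ≡⟨ ^ℚ-+ ½ a (ℕ.sum xs ∸ length xs) ⟨
    ½ ^ℚ (a ℕ.+ (ℕ.sum xs ∸ length xs))
  ≡⟨ cong (½ ^ℚ_) (ℕ.+-∸-assoc a (length≤sum xs pxs)) ⟨
    ½ ^ℚ (a ℕ.+ ℕ.sum xs ∸ length xs)
  ∎
  where
  open ≡.≡-Reasoning
  open +-*-Solver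
  share = diagonalShare (suc a) xs
  1+aC0≡1 : suc a C 0 ≡ 1
  1+aC0≡1 = ≡.trans (nCk≡nC[n∸k] {0} {suc a} z≤n) (nCn≡1 (suc a))
  halves : ∀ q e → (½ * q) * e + (½ * q) * e ≡ q * e
  halves = solve 2 (λ q e → (con ½ :* q) :* e :+ (con ½ :* q) :* e := q :* e) refl

P-diag : ∀ {λ′} → Positive λ′ → Descending λ′ → P λ′ λ′ ≡ ½ ^ℚ (ℕ.sum λ′ ∸ length λ′)
P-diag {λ′} pos desc = ≡.trans (P≡Punsorted pos desc) (Punsorted-diag λ′ pos)

-- The enumeration of partitions

record IsPartition (n : ℕ) (μ : List ℕ) : Set where
  field
    positive   : Positive μ
    descending : Descending μ
    sum≡       : ℕ.sum μ ≡ n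

partsGo-partitions : ∀ f m n → All (λ μ → IsPartition n μ × Head ℕ._≤_ μ m) (partsGo f m n)
partsGo-partitions f       m zero    =
  (record { positive = [] ; descending = tt ; sum≡ = refl } , tt) ∷ []
partsGo-partitions zero    m (suc n) = []
partsGo-partitions (suc f) m (suc n) =
  All.concat⁺ (All.map⁺ (All.applyUpTo⁺₁ suc (m ⊓ suc n) λ {k} k<m⊓n →
    All.map⁺ (All.map (extend k<m⊓n) (partsGo-partitions f (suc k) (suc n ∸ suc k)))))
  where
  extend : ∀ {k μ} → k ℕ.< m ⊓ suc n → IsPartition (suc n ∸ suc k) μ × Head ℕ._≤_ μ (suc k) →
           IsPartition (suc n) (suc k ∷ μ) × Head ℕ._≤_ (suc k ∷ μ) m
  extend {k} k<m⊓n (μ-part , μ≤1+k) =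
    record { positive   = s≤s z≤n ∷ positive
           ; descending = μ≤1+k , descending
           ; sum≡       = ≡.trans (cong (suc k ℕ.+_) sum≡)
                                  (ℕ.m+[n∸m]≡n (ℕ.m<n⊓o⇒m<o m (suc n) k<m⊓n)) }
    , ℕ.m<n⊓o⇒m<n m (suc n) k<m⊓n
    where open IsPartition μ-part

partitions-partition : ∀ n → All (IsPartition n) (partitions n)
partitions-partition n = All.map proj₁ (partsGo-partitions n n n)

<ₗ-blocks : ∀ (F : ℕ → List (List ℕ)) ks → AllPairs ℕ._<_ ks → (∀ k → AllPairs _<ₗ_ (F k)) →
            AllPairs _<ₗ_ (concatMap (λ k → map (k ∷_) (F k)) ks)
<ₗ-blocks F []       _            _  = []
<ₗ-blocks F (k ∷ ks) (k<ks ∷ ks↑) F↑ =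
  AllPairs.++⁺ (AllPairs.map⁺ (AllPairs.map (next refl) (F↑ k))) (<ₗ-blocks F ks ks↑ F↑)
    (All.map⁺ (All.universal (λ μ → All.map (λ later → later μ) laterBlocks) (F k)))
  where
  laterBlocks : All (λ ν → ∀ μ → (k ∷ μ) <ₗ ν) (concatMap (λ k′ → map (k′ ∷_) (F k′)) ks)
  laterBlocks = All.concat⁺ (All.map⁺ (All.map
    (λ k<k′ → All.map⁺ (All.universal (λ _ _ → this k<k′) _)) k<ks))

partsGo-<ₗ : ∀ f m n → AllPairs _<ₗ_ (partsGo f m n)
partsGo-<ₗ f       m zero    = [] ∷ []
partsGo-<ₗ zero    m (suc n) = []
partsGo-<ₗ (suc f) m (suc n) =
  <ₗ-blocks (λ k → partsGo f k (suc n ∸ k)) (applyUpTo suc (m ⊓ suc n))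
            (AllPairs.applyUpTo⁺₁ suc (m ⊓ suc n) (λ i<j _ → s≤s i<j))
            (λ k → partsGo-<ₗ f k (suc n ∸ k))

AllPairs-lookup : ∀ {A : Set} {R : A → A → Set} {xs} → AllPairs R xs →
                  ∀ {i j} → toℕ i ℕ.< toℕ j → R (lookup xs i) (lookup xs j)
AllPairs-lookup (Rx ∷ _)  {zero}  {suc j} _         = All.lookup Rx (∈-lookup j)
AllPairs-lookup (_ ∷ Rxs) {suc i} {suc j} (s≤s i<j) = AllPairs-lookup Rxs i<j

length-partition : ∀ {n μ} → 1 ℕ.≤ n → IsPartition n μ → 1 ℕ.≤ length μ × length μ ℕ.≤ n
length-partition {μ = []}    1≤n record { sum≡ = refl } = ⊥-elim (ℕ.<-irrefl refl 1≤n)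
length-partition {μ = a ∷ μ} _   μ-part                 =
  s≤s z≤n , ≡.subst (length (a ∷ μ) ℕ.≤_) sum≡ (length≤sum (a ∷ μ) positive)
  where open IsPartition μ-part

-- Regrouping the diagonal

multiplicity : ∀ {A : Set} → (A → ℕ) → List A → ℕ → ℕ
multiplicity ℓ xs k = length (filter (λ x → ℓ x ℕ.≟ k) xs)

^ℚ-multiplicity-∷ : ∀ {A : Set} q (ℓ : A → ℕ) x xs k →
  q ^ℚ multiplicity ℓ (x ∷ xs) k ≡ (if does (ℓ x ℕ.≟ k) then q else 1ℚ) * q ^ℚ multiplicity ℓ xs k
^ℚ-multiplicity-∷ q ℓ x xs k with does (ℓ x ℕ.≟ k)
... | true  = refl
... | false = ≡.sym (ℚ.*-identityˡ _)

prodℚ-multiplicities : ∀ {A : Set} (g : ℕ → ℚ) (ℓ : A → ℕ) n xs →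
  All (λ x → 1 ℕ.≤ ℓ x × ℓ x ℕ.≤ n) xs →
  prodℚ (map (λ x → g (n ∸ ℓ x)) xs) ≡ prodℚ (map (λ i → g i ^ℚ multiplicity ℓ xs (n ∸ i)) (upTo n))
prodℚ-multiplicities g ℓ n [] _ =
  ≡.sym (Prod.fold-ε (All.map⁺ (All.universal (λ _ → refl) (upTo n))))
prodℚ-multiplicities g ℓ n (x ∷ xs) ((1≤ℓx , ℓx≤n) ∷ bounds) = ≡.sym (begin
    prodℚ (map (λ i → g i ^ℚ multiplicity ℓ (x ∷ xs) (n ∸ i)) (upTo n))
  ≡⟨ cong prodℚ (List.map-cong (λ i → ^ℚ-multiplicity-∷ (g i) ℓ x xs (n ∸ i)) (upTo n)) ⟩
    prodℚ (map (λ i → hit i * rest i) (upTo n))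
  ≡⟨ Prod.fold-map-∙ hit rest (upTo n) ⟩
    prodℚ (map hit (upTo n)) * prodℚ (map rest (upTo n))
  ≡⟨ cong₂ _*_ (≡.trans (cong prodℚ (List.map-upTo hit n)) (Prod.fold-applyUpTo-single hit v<n missed))
               (≡.sym (prodℚ-multiplicities g ℓ n xs bounds)) ⟩
    hit v * prodℚ (map (λ y → g (n ∸ ℓ y)) xs)
  ≡⟨ cong (λ d → (if d then g v else 1ℚ) * prodℚ (map (λ y → g (n ∸ ℓ y)) xs))
          (dec-true (ℓ x ℕ.≟ n ∸ v) (≡.sym (ℕ.m∸[m∸n]≡n ℓx≤n))) ⟩
    g v * prodℚ (map (λ y → g (n ∸ ℓ y)) xs)
  ∎)
  where
  open ≡.≡-Reasoning
  hit rest : ℕ → ℚ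
  hit i  = if does (ℓ x ℕ.≟ n ∸ i) then g i else 1ℚ
  rest i = g i ^ℚ multiplicity ℓ xs (n ∸ i)
  v = n ∸ ℓ x
  v<n : v ℕ.< n
  v<n = ℕ.∸-monoʳ-< 1≤ℓx ℓx≤n
  missed : ∀ {i} → i ℕ.< n → i ≢ v → hit i ≡ 1ℚ
  missed {i} i<n i≢v = cong (λ d → if d then g i else 1ℚ) (dec-false (ℓ x ℕ.≟ n ∸ i) λ ℓx≡n∸i →
    i≢v (≡.trans (≡.sym (ℕ.m∸[m∸n]≡n (ℕ.<⇒≤ i<n))) (cong (n ∸_) (≡.sym ℓx≡n∸i))))

-- The characteristic polynomial

module _ (n : ℕ) where

  private
    partitionAt : ∀ i → IsPartition n (lookup (partitions n) i)
    partitionAt i = All.lookup (partitions-partition n) (∈-lookup i)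

  Pmat-aboveDiagonal : ∀ {i j} → toℕ i ℕ.< toℕ j → Pmat n i j ≡ 0ℚ
  Pmat-aboveDiagonal {i} i<j = P-<ₗ positive descending (AllPairs-lookup (partsGo-<ₗ n n n) i<j)
    where open IsPartition (partitionAt i)

  Pmat-diagonal : ∀ i → Pmat n i i ≡ ½ ^ℚ (n ∸ length (lookup (partitions n) i))
  Pmat-diagonal i = ≡.trans (P-diag positive descending)
    (cong (λ s → ½ ^ℚ (s ∸ length (lookup (partitions n) i))) sum≡)
    where open IsPartition (partitionAt i)

  charMatrix : ℚ → Fin (length (partitions n)) → Fin (length (partitions n)) → ℚ
  charMatrix x i j = x * δ i j - Pmat n i j

  charMatrix-lowerTriangular : ∀ x → LowerTriangular (charMatrix x)
  charMatrix-lowerTriangular x i<j =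
    cong₂ _-_ (≡.trans (cong (x *_) (δ-< i<j)) (ℚ.*-zeroʳ x)) (Pmat-aboveDiagonal i<j)

  charMatrix-diagonal : ∀ x i → charMatrix x i i ≡ x - ½ ^ℚ (n ∸ length (lookup (partitions n) i))
  charMatrix-diagonal x i =
    cong₂ _-_ (≡.trans (cong (x *_) (δ-refl i)) (ℚ.*-identityʳ x)) (Pmat-diagonal i)

proposition4p2 : (n : ℕ) → 1 ℕ.≤ n → (x : ℚ) →
    charPoly n x ≡ prodℚ (map (λ i → (x - (½ ^ℚ i)) ^ℚ p n (n ∸ i)) (upTo n))
proposition4p2 n 1≤n x = begin
    charPoly n x
  ≡⟨ det-lowerTriangular _ (charMatrix n x) (charMatrix-lowerTriangular n x) ⟩
    prodℚ (tabulate (λ i → charMatrix n x i i))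
  ≡⟨ cong prodℚ (List.tabulate-cong (charMatrix-diagonal n x)) ⟩
    prodℚ (tabulate (factor ∘ lookup (partitions n)))
  ≡⟨ cong prodℚ (≡.trans (≡.sym (List.map-tabulate (lookup (partitions n)) factor))
                         (cong (map factor) (List.tabulate-lookup (partitions n)))) ⟩
    prodℚ (map factor (partitions n))
  ≡⟨ prodℚ-multiplicities (λ i → x - ½ ^ℚ i) length n (partitions n)
       (All.map (length-partition 1≤n) (partitions-partition n)) ⟩
    prodℚ (map (λ i → (x - (½ ^ℚ i)) ^ℚ p n (n ∸ i)) (upTo n))
  ∎
  where
  open ≡.≡-Reasoning
  factor : List ℕ → ℚ
  factor μ = x - ½ ^ℚ (n ∸ length μ)
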